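{- Let $J$ be a finite $r$-uniform hypergraph, and let $X\subseteq V(J)$ be such that $d_J(v)\geq 1$ for every vertex $v\in V(J)\setminus X$. Let $m:= |V(J)\setminus X|$. Then there exists an ordering $v_1,\ldots, v_m$ of $V(J)\setminus X$ such that the number of indices $i\in [m]$ with $d_{J[X\cup \{v_j: j\in [i]\}]}(v_i)\ge 1$ is at least $\frac{1}{r} |V(J)\setminus X|$.
   Context: $d_J(v)$ is the number of edges of $J$ containing $v$; $J[Y]$ is the subhypergraph induced on the vertex set $Y$ (edges of $J$ contained in $Y$). -}

module Defs where

open import Data.Nat using (ℕ; suc)
open import Data.Fin using (Fin)
open import Data.Fin.Subset using (Subset; ⊥; ⁅_⁆; _∪_; _∈_; _⊆_; ∣_∣)
open import Data.Fin.Subset.Properties using (_∈?_; _⊆?_)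
open import Data.List using (List; length; filter; foldr; take)
open import Data.List.Relation.Unary.Unique.Propositional using (Unique)
open import Data.List.Relation.Unary.All using (All)
open import Relation.Binary.PropositionalEquality using (_≡_)

record Hypergraph (n r : ℕ) : Set where
  field
    edges   : List (Subset n)
    unique  : Unique edges
    uniform : All (λ e → ∣ e ∣ ≡ r) edges
open Hypergraph public

degree : ∀ {n r} → Hypergraph n r → Fin n → ℕ
degree J v = length (filter (λ e → v ∈? e) (edges J))

induced-edges : ∀ {n} → List (Subset n) → Subset n → List (Subset n)
induced-edges es Y = filter (λ e → e ⊆? Y) es

inducedDegree : ∀ {n r} → Hypergraph n r → Subset n → Fin n → ℕ
inducedDegree J Y v = length (filter (λ e → v ∈? e) (induced-edges (edges J) Y))

setOf : ∀ {n} → List (Fin n) → Subset n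
setOf = foldr (λ v S → ⁅ v ⁆ ∪ S) ⊥

{-# OPTIONS --safe #-}
-- Greedy construction: run through the vertices; whenever the current vertex w lies
-- outside the set Y built so far, pick an edge e ∋ w (it exists as d_J(w) ≥ 1) and
-- append the vertices of e outside Y, in any order.  Such a block has at most r
-- vertices, and its last vertex v_i lies in e ⊆ X ∪ {v_1, …, v_i}, so every block
-- contributes at least one counted index.
module Submission where

open import Defs
open import Data.Nat using (ℕ; suc; _+_; _≤_; _*_; _≤?_; z≤n; s≤s)
open import Data.Nat.Properties using (≤-trans; ≤-reflexive; n≤1+n; +-mono-≤; *-monoʳ-≤; *-suc; module ≤-Reasoning)
open import Data.Fin using (Fin; zero; suc; toℕ)
open import Data.Fin.Subset using (Subset; _∈_; _∉_; _∪_; ∁; ∣_∣; ⁅_⁆; _⊆_; inside; outside)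
open import Data.Fin.Subset.Properties using (_∈?_; _⊆?_; ∉⊥; x∈⁅x⁆; x∈⁅y⁆⇒x≡y; x∈p∪q⁻; x∈p∪q⁺; x∈∁p⇒x∉p; ∪-assoc; ∪-identityˡ; ∪-identityʳ; ∣⊥∣≡0; p⊆q⇒∣p∣≤∣q∣)
open import Data.Vec using (_∷_; here; there)
open import Data.List using (List; []; _∷_; _++_; [_]; length; filter; take; lookup; tabulate; allFin)
open import Data.List.Properties using (length-++; filter-accept; filter-reject; filter-≐)
open import Data.List.Membership.Propositional using () renaming (_∈_ to _∈ₗ_)
open import Data.List.Membership.Propositional.Properties using (∈-filter⁺; ∈-filter⁻; ∈-++⁻; ∈-++⁺ˡ; ∈-++⁺ʳ; ∈-allFin)
open import Data.List.Relation.Unary.Any using () renaming (here to hereₗ; there to thereₗ)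
open import Data.List.Relation.Unary.All as All using (All; []; _∷_)
open import Data.List.Relation.Unary.AllPairs using ([]; _∷_)
open import Data.List.Relation.Unary.Unique.Propositional using (Unique)
open import Data.List.Relation.Unary.Unique.Propositional.Properties using (filter⁺; allFin⁺; ++⁺)
open import Data.Bool using (true; false)
open import Data.Product using (Σ; _×_; ∃-syntax; _,_; proj₁; proj₂)
open import Data.Sum using (inj₁; inj₂; [_,_]′)
open import Function using (_∘_)
open import Function.Bundles using (_⇔_; mk⇔)
open import Level using (Level)
open import Relation.Nullary using (yes; no; does; contradiction)
open import Relation.Nullary.Decidable using (_×-dec_; ¬?)
open import Relation.Binary.PropositionalEquality using (_≡_; refl; sym; trans; cong; subst)
open import Relation.Unary using (Pred; Decidable)

private
  variable
    a p : Level
    A : Set a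
    n k : ℕ

length-filter-tabulate : {P : Pred A p} (P? : Decidable P) (f : Fin k → A) →
  length (filter P? (tabulate f)) ≡ length (filter (P? ∘ f) (allFin k))
length-filter-tabulate {k = ℕ.zero} P? f = refl
length-filter-tabulate {k = suc k} P? f
  with does (P? (f zero)) | trans (length-filter-tabulate P? (f ∘ suc)) (sym (length-filter-tabulate (P? ∘ f) suc))
... | true  | tail = cong suc tail
... | false | tail = tail

∈⇒1≤length : {x : A} {xs : List A} → x ∈ₗ xs → 1 ≤ length xs
∈⇒1≤length (hereₗ _)  = s≤s z≤n
∈⇒1≤length (thereₗ _) = s≤s z≤n

1≤length⇒∃∈ : {xs : List A} → 1 ≤ length xs → ∃[ x ] x ∈ₗ xs
1≤length⇒∃∈ {xs = x ∷ _} _ = x , hereₗ refl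

∈-setOf⁺ : {x : Fin n} {xs : List (Fin n)} → x ∈ₗ xs → x ∈ setOf xs
∈-setOf⁺ (hereₗ refl) = x∈p∪q⁺ (inj₁ (x∈⁅x⁆ _))
∈-setOf⁺ (thereₗ x∈)  = x∈p∪q⁺ (inj₂ (∈-setOf⁺ x∈))

∈-setOf⁻ : {x : Fin n} (xs : List (Fin n)) → x ∈ setOf xs → x ∈ₗ xs
∈-setOf⁻ []       x∈ = contradiction x∈ ∉⊥
∈-setOf⁻ (y ∷ ys) x∈ with x∈p∪q⁻ ⁅ y ⁆ (setOf ys) x∈
... | inj₁ x∈⁅y⁆ = hereₗ (x∈⁅y⁆⇒x≡y y x∈⁅y⁆)
... | inj₂ x∈ys  = thereₗ (∈-setOf⁻ ys x∈ys)

x∉p⇒∣⁅x⁆∪p∣≡1+∣p∣ : {x : Fin n} {p : Subset n} → x ∉ p → ∣ ⁅ x ⁆ ∪ p ∣ ≡ suc ∣ p ∣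
x∉p⇒∣⁅x⁆∪p∣≡1+∣p∣ {x = zero}  {outside ∷ p} _   = cong (suc ∘ ∣_∣) (∪-identityˡ p)
x∉p⇒∣⁅x⁆∪p∣≡1+∣p∣ {x = zero}  {inside  ∷ p} x∉p = contradiction here x∉p
x∉p⇒∣⁅x⁆∪p∣≡1+∣p∣ {x = suc x} {outside ∷ p} x∉p = x∉p⇒∣⁅x⁆∪p∣≡1+∣p∣ (x∉p ∘ there)
x∉p⇒∣⁅x⁆∪p∣≡1+∣p∣ {x = suc x} {inside  ∷ p} x∉p = cong suc (x∉p⇒∣⁅x⁆∪p∣≡1+∣p∣ (x∉p ∘ there))

∣setOf∣≡length : {xs : List (Fin n)} → Unique xs → ∣ setOf xs ∣ ≡ length xs
∣setOf∣≡length {n} {[]}     _             = ∣⊥∣≡0 n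
∣setOf∣≡length {xs = x ∷ xs} (x∉xs ∷ uxs) =
  trans (x∉p⇒∣⁅x⁆∪p∣≡1+∣p∣ (λ x∈ → All.lookup x∉xs (∈-setOf⁻ xs x∈) refl)) (cong suc (∣setOf∣≡length uxs))

∪-setOf-∷ : (Y : Subset n) (v : Fin n) (vs : List (Fin n)) → Y ∪ setOf (v ∷ vs) ≡ (Y ∪ ⁅ v ⁆) ∪ setOf vs
∪-setOf-∷ Y v vs = sym (∪-assoc Y ⁅ v ⁆ (setOf vs))

module _ (e Y : Subset n) where

  private
    new? : Decidable (λ u → u ∈ e × u ∉ Y)
    new? u = u ∈? e ×-dec ¬? (u ∈? Y)

  fresh : List (Fin n)
  fresh = filter new? (allFin n)

  ∈-fresh⁺ : {u : Fin n} → u ∈ e → u ∉ Y → u ∈ₗ fresh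
  ∈-fresh⁺ {u} u∈e u∉Y = ∈-filter⁺ new? (∈-allFin u) (u∈e , u∉Y)

  ∈-fresh⁻ : {u : Fin n} → u ∈ₗ fresh → u ∈ e × u ∉ Y
  ∈-fresh⁻ u∈ = proj₂ (∈-filter⁻ new? {xs = allFin n} u∈)

  fresh-unique : Unique fresh
  fresh-unique = filter⁺ new? (allFin⁺ n)

  length-fresh≤∣e∣ : length fresh ≤ ∣ e ∣
  length-fresh≤∣e∣ = ≤-trans (≤-reflexive (sym (∣setOf∣≡length fresh-unique)))
                       (p⊆q⇒∣p∣≤∣q∣ (proj₁ ∘ ∈-fresh⁻ ∘ ∈-setOf⁻ fresh))

  e⊆Y∪fresh : e ⊆ Y ∪ setOf fresh
  e⊆Y∪fresh {u} u∈e with u ∈? Y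
  ... | yes u∈Y = x∈p∪q⁺ (inj₁ u∈Y)
  ... | no  u∉Y = x∈p∪q⁺ (inj₂ (∈-setOf⁺ (∈-fresh⁺ u∈e u∉Y)))

module _ {n r : ℕ} (J : Hypergraph n r) where

  edge-containing : {v : Fin n} → 1 ≤ degree J v → ∃[ e ] e ∈ₗ edges J × v ∈ e
  edge-containing {v} d with 1≤length⇒∃∈ d
  ... | e , e∈ = e , ∈-filter⁻ (v ∈?_) e∈

  inducedDegree-pos : {e Z : Subset n} {v : Fin n} → e ∈ₗ edges J → e ⊆ Z → v ∈ e → 1 ≤ inducedDegree J Z v
  inducedDegree-pos {Z = Z} {v} e∈ e⊆Z v∈e = ∈⇒1≤length (∈-filter⁺ (v ∈?_) (∈-filter⁺ (_⊆? Z) e∈ e⊆Z) v∈e)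

  Completes : (Y : Subset n) (vs : List (Fin n)) → Pred (Fin (length vs)) _
  Completes Y vs i = 1 ≤ inducedDegree J (Y ∪ setOf (take (suc (toℕ i)) vs)) (lookup vs i)

  completes? : (Y : Subset n) (vs : List (Fin n)) → Decidable (Completes Y vs)
  completes? Y vs i = 1 ≤? inducedDegree J (Y ∪ setOf (take (suc (toℕ i)) vs)) (lookup vs i)

  #completing : Subset n → List (Fin n) → ℕ
  #completing Y vs = length (filter (completes? Y vs) (allFin (length vs)))

  #completing-tail : (Y : Subset n) (v : Fin n) (vs : List (Fin n)) →
    length (filter (completes? Y (v ∷ vs)) (tabulate suc)) ≡ #completing (Y ∪ ⁅ v ⁆) vs
  #completing-tail Y v vs = trans (length-filter-tabulate (completes? Y (v ∷ vs)) suc)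
    (cong length (filter-≐ (completes? Y (v ∷ vs) ∘ suc) (completes? (Y ∪ ⁅ v ⁆) vs)
      ((λ {i} → move (prefix i)) , (λ {i} → move (sym (prefix i)))) (allFin (length vs))))
    where
      prefix : (i : Fin (length vs)) → Y ∪ setOf (take (suc (toℕ (suc i))) (v ∷ vs)) ≡ (Y ∪ ⁅ v ⁆) ∪ setOf (take (suc (toℕ i)) vs)
      prefix i = ∪-setOf-∷ Y v (take (suc (toℕ i)) vs)

      move : {Z Z′ : Subset n} {u : Fin n} → Z ≡ Z′ → 1 ≤ inducedDegree J Z u → 1 ≤ inducedDegree J Z′ u
      move {u = u} eq = subst (λ Z → 1 ≤ inducedDegree J Z u) eq

  #completing-∷-completes : (Y : Subset n) (v : Fin n) (vs : List (Fin n)) → Completes Y (v ∷ vs) zero →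
    #completing Y (v ∷ vs) ≡ suc (#completing (Y ∪ ⁅ v ⁆) vs)
  #completing-∷-completes Y v vs c =
    trans (cong length (filter-accept (completes? Y (v ∷ vs)) c)) (cong suc (#completing-tail Y v vs))

  #completing-∷-≥ : (Y : Subset n) (v : Fin n) (vs : List (Fin n)) →
    #completing (Y ∪ ⁅ v ⁆) vs ≤ #completing Y (v ∷ vs)
  #completing-∷-≥ Y v vs with completes? Y (v ∷ vs) zero
  ... | yes c = ≤-trans (n≤1+n _) (≤-reflexive (sym (#completing-∷-completes Y v vs c)))
  ... | no ¬c = ≤-reflexive (sym (trans (cong length (filter-reject (completes? Y (v ∷ vs)) ¬c))
                                        (#completing-tail Y v vs)))

  -- The last vertex of the block L completes e.
  completing-block : {e : Subset n} {x : Fin n} (Y : Subset n) (L M : List (Fin n)) →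
    e ∈ₗ edges J → x ∈ₗ L → All (_∈ e) L → e ⊆ Y ∪ setOf L →
    suc (#completing (Y ∪ setOf L) M) ≤ #completing Y (L ++ M)
  completing-block Y (u ∷ []) M e∈ _ (u∈e ∷ []) e⊆ = begin
    suc (#completing (Y ∪ setOf [ u ]) M) ≡⟨ cong (λ Z → suc (#completing (Y ∪ Z) M)) (∪-identityʳ ⁅ u ⁆) ⟩
    suc (#completing (Y ∪ ⁅ u ⁆) M)       ≡⟨ sym (#completing-∷-completes Y u M (inducedDegree-pos e∈ e⊆ u∈e)) ⟩
    #completing Y (u ∷ M)                 ∎
    where open ≤-Reasoning
  completing-block Y (u ∷ L@(_ ∷ _)) M e∈ _ (_ ∷ L⊆e) e⊆ = begin
    suc (#completing (Y ∪ setOf (u ∷ L)) M)     ≡⟨ cong (λ Z → suc (#completing Z M)) (∪-setOf-∷ Y u L) ⟩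
    suc (#completing ((Y ∪ ⁅ u ⁆) ∪ setOf L) M) ≤⟨ completing-block (Y ∪ ⁅ u ⁆) L M e∈ (hereₗ refl) L⊆e
                                                     (subst (_ ⊆_) (∪-setOf-∷ Y u L) e⊆) ⟩
    #completing (Y ∪ ⁅ u ⁆) (L ++ M)            ≤⟨ #completing-∷-≥ Y u (L ++ M) ⟩
    #completing Y (u ∷ L ++ M)                  ∎
    where open ≤-Reasoning

  record GreedyOrdering (ws : List (Fin n)) (Y : Subset n) : Set where
    field
      vs       : List (Fin n)
      distinct : Unique vs
      disjoint : {v : Fin n} → v ∈ₗ vs → v ∉ Y
      covers   : {w : Fin n} → w ∈ₗ ws → w ∉ Y → w ∈ₗ vs
      bound    : length vs ≤ r * #completing Y vs

  prepend-fresh : {ws : List (Fin n)} {Y e : Subset n} {w : Fin n} → e ∈ₗ edges J → w ∈ e → w ∉ Y →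
    GreedyOrdering ws (Y ∪ setOf (fresh e Y)) → GreedyOrdering (w ∷ ws) Y
  prepend-fresh {ws} {Y} {e} {w} e∈ w∈e w∉Y o = record
    { vs       = L ++ vs
    ; distinct = ++⁺ (fresh-unique e Y) distinct (λ (u∈L , u∈vs) → disjoint u∈vs (x∈p∪q⁺ (inj₂ (∈-setOf⁺ u∈L))))
    ; disjoint = disjoint′
    ; covers   = covers′
    ; bound    = bound′
    }
    where
      open GreedyOrdering o
      L = fresh e Y
      Y′ = Y ∪ setOf L

      disjoint′ : {v : Fin n} → v ∈ₗ L ++ vs → v ∉ Y
      disjoint′ v∈ with ∈-++⁻ L v∈
      ... | inj₁ v∈L  = proj₂ (∈-fresh⁻ e Y v∈L)
      ... | inj₂ v∈vs = disjoint v∈vs ∘ x∈p∪q⁺ ∘ inj₁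

      covers′ : {x : Fin n} → x ∈ₗ w ∷ ws → x ∉ Y → x ∈ₗ L ++ vs
      covers′ (hereₗ refl) _ = ∈-++⁺ˡ (∈-fresh⁺ e Y w∈e w∉Y)
      covers′ {x} (thereₗ x∈ws) x∉Y with x ∈? setOf L
      ... | yes x∈L = ∈-++⁺ˡ (∈-setOf⁻ L x∈L)
      ... | no  x∉L = ∈-++⁺ʳ L (covers x∈ws ([ x∉Y , x∉L ]′ ∘ x∈p∪q⁻ Y (setOf L)))

      bound′ : length (L ++ vs) ≤ r * #completing Y (L ++ vs)
      bound′ = begin
        length (L ++ vs)                 ≡⟨ length-++ L ⟩
        length L + length vs             ≤⟨ +-mono-≤ (≤-trans (length-fresh≤∣e∣ e Y) (≤-reflexive (All.lookup (uniform J) e∈))) bound ⟩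
        r + r * #completing Y′ vs        ≡⟨ sym (*-suc r _) ⟩
        r * suc (#completing Y′ vs)      ≤⟨ *-monoʳ-≤ r (completing-block Y L vs e∈ (∈-fresh⁺ e Y w∈e w∉Y)
                                              (All.tabulate (proj₁ ∘ ∈-fresh⁻ e Y)) (e⊆Y∪fresh e Y)) ⟩
        r * #completing Y (L ++ vs)      ∎
        where open ≤-Reasoning

  -- ws lists the vertices still to be examined; recursing on it stands in for
  -- well-founded recursion on ∣ ∁ Y ∣.
  greedy : (ws : List (Fin n)) (Y : Subset n) → ((v : Fin n) → v ∉ Y → 1 ≤ degree J v) → GreedyOrdering ws Y
  greedy []       Y _ = record { vs = [] ; distinct = [] ; disjoint = λ () ; covers = λ () ; bound = z≤n }
  greedy (w ∷ ws) Y covered with w ∈? Y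
  ... | yes w∈Y = record { vs = vs ; distinct = distinct ; disjoint = disjoint ; covers = covers′ ; bound = bound }
    where
      open GreedyOrdering (greedy ws Y covered)

      covers′ : {x : Fin n} → x ∈ₗ w ∷ ws → x ∉ Y → x ∈ₗ vs
      covers′ (hereₗ refl) w∉Y = contradiction w∈Y w∉Y
      covers′ (thereₗ x∈ws)    = covers x∈ws
  ... | no  w∉Y with edge-containing (covered w w∉Y)
  ... | e , e∈ , w∈e = prepend-fresh e∈ w∈e w∉Y
          (greedy ws (Y ∪ setOf (fresh e Y)) (λ v v∉ → covered v (v∉ ∘ x∈p∪q⁺ ∘ inj₁)))

proposition4p1 : (n r : ℕ) (J : Hypergraph n r) (X : Subset n) →
    ((v : Fin n) → v ∉ X → 1 ≤ degree J v) →
    Σ (List (Fin n)) λ vs →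
      Unique vs × ((v : Fin n) → (v ∈ₗ vs) ⇔ (v ∉ X)) ×
      ∣ ∁ X ∣ ≤ r * length (filter
        (λ i → 1 ≤? inducedDegree J (X ∪ setOf (take (suc (toℕ i)) vs)) (lookup vs i))
        (allFin (length vs)))
proposition4p1 n r J X covered = vs , distinct , (λ v → mk⇔ disjoint (covers (∈-allFin v))) , (begin
    ∣ ∁ X ∣                ≤⟨ p⊆q⇒∣p∣≤∣q∣ (∈-setOf⁺ ∘ covers (∈-allFin _) ∘ x∈∁p⇒x∉p) ⟩
    ∣ setOf vs ∣           ≡⟨ ∣setOf∣≡length distinct ⟩
    length vs              ≤⟨ bound ⟩
    r * #completing J X vs ∎)
  where
    open GreedyOrdering (greedy J (allFin n) X covered)
    open ≤-Reasoning
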